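{- Let $d$ be a positive integer and let $f\colon\mathbb{N}^d\to\mathbb{N}$ be a $d$-tupling function. If $f$ has diagonal shells or cubic shells, then $f$ is max-dominating, i.e. $\max(\mathbf{x})\le f(\mathbf{x})$ for all $\mathbf{x}\in\mathbb{N}^d$.
   Context: $\mathbb{N}$ denotes the set of non-negative integers. A $d$-tupling function for $\mathbb{N}$ is a bijection from $\mathbb{N}^d$ to $\mathbb{N}$. A function $\sigma\colon\mathbb{N}^d\to\mathbb{N}$ is a shell numbering for a $d$-tupling function $f$ if for all $\mathbf{x},\mathbf{y}\in\mathbb{N}^d$, $\sigma(\mathbf{x})<\sigma(\mathbf{y})$ implies $f(\mathbf{x})<f(\mathbf{y})$. $f$ has diagonal shells if $(x_1,\ldots,x_d)\mapsto x_1+\cdots+x_d$ is a shell numbering for $f$, and cubic shells if $(x_1,\ldots,x_d)\mapsto\max(x_1,\ldots,x_d)$ is a shell numbering for $f$. A function $f\colon\mathbb{N}^d\to\mathbb{N}$ is max-dominating if $\max(\mathbf{x})\le f(\mathbf{x})$ for all $\mathbf{x}\in\mathbb{N}^d$. -}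

module Defs where

open import Data.Nat using (ℕ; _+_; _⊔_; _<_; _≤_)
open import Data.Vec.Functional using (Vector; foldr)
open import Function.Definitions using (Bijective)
open import Relation.Binary.PropositionalEquality using (_≡_)

sumV : ∀ {d} → Vector ℕ d → ℕ
sumV = foldr _+_ 0

-- max(x₁,…,x_d) (with max of the empty tuple = 0; irrelevant since d ≥ 1).
maxV : ∀ {d} → Vector ℕ d → ℕ
maxV = foldr _⊔_ 0

IsTupling : (d : ℕ) → (Vector ℕ d → ℕ) → Set
IsTupling d f = Bijective {A = Vector ℕ d} _≡_ _≡_ f

IsShellNumbering : (d : ℕ) → (Vector ℕ d → ℕ) → (Vector ℕ d → ℕ) → Set
IsShellNumbering d σ f = ∀ (x y : Vector ℕ d) → σ x < σ y → f x < f y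

HasDiagonalShells : (d : ℕ) → (Vector ℕ d → ℕ) → Set
HasDiagonalShells d f = IsShellNumbering d sumV f

HasCubicShells : (d : ℕ) → (Vector ℕ d → ℕ) → Set
HasCubicShells d f = IsShellNumbering d maxV f

MaxDominating : (d : ℕ) → (Vector ℕ d → ℕ) → Set
MaxDominating d f = ∀ (x : Vector ℕ d) → maxV x ≤ f x

module Submission where

-- Let σ be a shell numbering for f : ℕ^(d+1) → ℕ.  The proof uses only two
-- features of σ, both shared by the diagonal (sum) and cubic (max) shells:
--   (a) every level k is attained, namely by the axis point kꞏe₁ = (k,0,…,0);
--   (b) σ dominates the maximum, max(x) ≤ σ(x).
-- From (a), f is strictly increasing along the axis, so k ≤ f(kꞏe₁) by
-- induction on k.  Given x with max(x) = k+1, (b) gives σ(kꞏe₁) = k < σ(x),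
-- hence k ≤ f(kꞏe₁) < f(x).  The theorem follows by computing sum and max on
-- the axis and noting max ≤ sum.

open import Defs
open import Data.Nat using (ℕ; suc; zero; _+_; _⊔_; _≤_; _<_; z≤n; s≤s)
open import Data.Nat.Properties
  using (≤-refl; ≤-trans; <-≤-trans; +-identityʳ; ⊔-identityʳ; ⊔-lub; m≤m+n; m≤n+m)
open import Data.Sum using (_⊎_; inj₁; inj₂)
open import Data.Vec.Functional using (Vector; head; tail)
open import Data.Fin using (Fin)
open import Relation.Binary.PropositionalEquality using (_≡_; refl; cong; subst; sym; trans)

axis : ∀ {d} → ℕ → Vector ℕ (suc d)
axis k Fin.zero    = k
axis k (Fin.suc i) = 0

record AxisShells (d : ℕ) (σ : Vector ℕ (suc d) → ℕ) : Set where
  field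
    onAxis   : ∀ k → σ (axis k) ≡ k
    maxBelow : ∀ x → maxV x ≤ σ x

sumV-zero : ∀ d → sumV {d} (λ _ → 0) ≡ 0
sumV-zero zero    = refl
sumV-zero (suc d) = sumV-zero d

maxV-zero : ∀ d → maxV {d} (λ _ → 0) ≡ 0
maxV-zero zero    = refl
maxV-zero (suc d) = maxV-zero d

maxV≤sumV : ∀ {d} (x : Vector ℕ d) → maxV x ≤ sumV x
maxV≤sumV {zero}  x = z≤n
maxV≤sumV {suc d} x =
  ⊔-lub (m≤m+n (head x) _) (≤-trans (maxV≤sumV (tail x)) (m≤n+m _ (head x)))

sumV-axisShells : ∀ d → AxisShells d sumV
sumV-axisShells d = record
  { onAxis   = λ k → trans (cong (k +_) (sumV-zero d)) (+-identityʳ k)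
  ; maxBelow = maxV≤sumV
  }

maxV-axisShells : ∀ d → AxisShells d maxV
maxV-axisShells d = record
  { onAxis   = λ k → trans (cong (k ⊔_) (maxV-zero d)) (⊔-identityʳ k)
  ; maxBelow = λ _ → ≤-refl
  }

module _ {d : ℕ} {σ : Vector ℕ (suc d) → ℕ} (shells : AxisShells d σ)
         {f : Vector ℕ (suc d) → ℕ} (shellNumbering : IsShellNumbering (suc d) σ f)
         where
  open AxisShells shells

  above-axis : ∀ k x → k < σ x → f (axis k) < f x
  above-axis k x k<σx = shellNumbering (axis k) x (subst (_< σ x) (sym (onAxis k)) k<σx)

  axis-dominated : ∀ k → k ≤ f (axis k)
  axis-dominated zero    = z≤n
  axis-dominated (suc k) =
    <-≤-trans (s≤s (axis-dominated k))
              (above-axis k (axis (suc k)) (subst (k <_) (sym (onAxis (suc k))) ≤-refl))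

  shells⇒maxDominating : MaxDominating (suc d) f
  shells⇒maxDominating x with maxV x in maxV-x
  ... | zero  = z≤n
  ... | suc k =
    <-≤-trans (s≤s (axis-dominated k))
              (above-axis k x (subst (_≤ σ x) maxV-x (maxBelow x)))

lemma7 : (d : ℕ) → (f : Vector ℕ (suc d) → ℕ) → IsTupling (suc d) f →
    (HasDiagonalShells (suc d) f ⊎ HasCubicShells (suc d) f) → MaxDominating (suc d) f
lemma7 d f _ (inj₁ diagonal) = shells⇒maxDominating (sumV-axisShells d) diagonal
lemma7 d f _ (inj₂ cubic)    = shells⇒maxDominating (maxV-axisShells d) cubic
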